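{- Let $n\ge1$ and $k\ge0$ be integers. Let $\mathcal O\subseteq[n]$ be a set with $k+1$ elements and $1\in\mathcal O$. Then for every partition $\pi\in\mathcal P_n^{k+1}(\mathcal O)$, $$\mathrm{los}(\pi)+\mathrm{linv}(\mathcal O,\pi)=\sum_{x\in\mathcal O,\ x\neq1}(n-x+1).$$ In particular $\mathrm{los}+\mathrm{linv}(\mathcal O,\cdot)$ is constant on $\mathcal P_n^{k+1}(\mathcal O)$.
   Context: $\mathcal P_n^{m}$ denotes the set of set partitions of $[n]$ into $m$ blocks, written $\pi=B_1-\cdots-B_m$ with the blocks listed in increasing order of their smallest elements. Let $w_i$ be the index of the block containing $i$. The openers $\mathcal O(\pi)$ are the smallest elements of the blocks. $\mathcal P_n^{k+1}(\mathcal O)$ is the set of $\pi\in\mathcal P_n^{k+1}$ with $\mathcal O(\pi)=\mathcal O$. Define $\mathrm{los}(\pi)=\sum_{i\in[n]}\#\{j\in\mathcal O(\pi): j<i,\ w_j<w_i\}$. For $b\in B_j$ let $\mathrm{linv}(b,\pi)=\sum_{i<j}\#\{a\in B_i: a>b\}$, and set $\mathrm{linv}(\mathcal O,\pi)=\sum_{b\in\mathcal O(\pi)}\mathrm{linv}(b,\pi)$. -}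

module Defs where

open import Data.Nat using (ℕ; zero; suc; _+_; _∸_; _<_; _<ᵇ_; _≡ᵇ_)
open import Data.Bool using (Bool; true; false; _∧_; not; if_then_else_)
open import Data.Fin using (Fin; toℕ; zero; suc)
open import Data.Product using (Σ; _×_; ∃)
open import Relation.Binary.PropositionalEquality using (_≡_)

-- Elements of [n] = {1,…,n} are represented by i : Fin n, standing for toℕ i + 1.
-- A partition π = B_1 - ⋯ - B_m of [n] into m blocks (blocks listed by increasing
-- smallest element) is represented by its block-index map w : Fin n → Fin m
-- (w i = index of the block containing i, 0-based).

ΣFin : (n : ℕ) → (Fin n → ℕ) → ℕ
ΣFin zero    f = 0
ΣFin (suc n) f = f zero + ΣFin n (λ i → f (suc i))

[_] : Bool → ℕ
[ true ]  = 1
[ false ] = 0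

_<F_ : ∀ {n} → Fin n → Fin n → Bool
i <F j = toℕ i <ᵇ toℕ j

_≡F_ : ∀ {n} → Fin n → Fin n → Bool
i ≡F j = toℕ i ≡ᵇ toℕ j

IsOrderedPartition : (n m : ℕ) → (Fin n → Fin m) → Set
IsOrderedPartition n m w =
  ((j : Fin m) → ∃ λ i → w i ≡ j) ×
  ((j j' : Fin m) (b : Fin n) → toℕ j < toℕ j' → w b ≡ j' →
     ∃ λ a → (toℕ a < toℕ b) × (w a ≡ j))

isOpener : ∀ {n m} → (Fin n → Fin m) → Fin n → Bool
isOpener {n} w i = not (anyBelow n (λ j → (j <F i) ∧ (w j ≡F w i)))
  where
  anyBelow : (k : ℕ) → (Fin k → Bool) → Bool
  anyBelow zero    p = false
  anyBelow (suc k) p = if p zero then true else anyBelow k (λ x → p (suc x))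

los : ∀ {n m} → (Fin n → Fin m) → ℕ
los {n} w = ΣFin n λ i → ΣFin n λ j →
  [ isOpener w j ∧ (j <F i) ∧ (w j <F w i) ]

linvElem : ∀ {n m} → (Fin n → Fin m) → Fin n → ℕ
linvElem {n} w b = ΣFin n λ a → [ (w a <F w b) ∧ (b <F a) ]

linvO : ∀ {n m} → (Fin n → Fin m) → ℕ
linvO {n} w = ΣFin n λ b → if isOpener w b then linvElem w b else 0

{-# OPTIONS --safe #-}
-- For an opener j and an element i > j exactly one of w_j < w_i, w_i < w_j,
-- w_j = w_i holds.  The first two cases are the pairs counted by los and by
-- linv(O, ·); the third occurs, for fixed i, once if i is not an opener (j is
-- then the opener of the block of i) and never otherwise.  Hence
-- los + linv(O, ·) = Σ_{j ∈ O} (n − j) − (n − |O|), and splitting off the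
-- term of the opener 1 turns this into the right-hand side.
module Submission where

open import Defs
open import Data.Nat using (ℕ; suc; _≤_; _∸_; _+_; _≡ᵇ_)
open import Data.Vec using (lookup)
open import Data.Fin using (Fin; toℕ)
open import Data.Fin.Subset using (Subset; _∈_; ∣_∣)
open import Data.Bool using (true; false; if_then_else_; _∧_; not)
open import Data.Product using (Σ; _×_)
open import Relation.Binary.PropositionalEquality using (_≡_)

open import Algebra.Properties.CommutativeMonoid.Sum as Sum using ()
open import Data.Bool using (Bool; T)
open import Data.Bool.Properties using (T-≡; T-∧; ⇔→≡; ∧-identityʳ; ∧-zeroʳ)
open import Data.Fin using (zero; suc; _<_)
open import Data.Fin.Induction using (<-wellFounded)
open import Data.Fin.Properties using (toℕ-injective; toℕ<n; suc-injective; <-cmp)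
open import Data.Nat using (zero; _<ᵇ_; z<s; s<s; s≤s; s<s⁻¹)
open import Data.Nat.Properties
  using (+-0-commutativeMonoid; +-identityʳ; +-∸-assoc; +-cancelʳ-≡; ≤-refl; ≤-trans; <⇒≤;
         <ᵇ⇒<; <⇒<ᵇ; ≡ᵇ⇒≡; ≡⇒≡ᵇ)
open import Data.Product using (∃; _,_; proj₁; proj₂)
open import Data.Vec.Properties using ([]=⇒lookup; lookup⇒[]=)
open import Function using (_∘_; _⇔_; mk⇔; Equivalence)
open import Induction.WellFounded using (Acc; acc)
open import Relation.Binary using (tri<; tri≈; tri>)
open import Relation.Binary.PropositionalEquality using (refl; sym; trans; cong; cong₂; module ≡-Reasoning)
open import Relation.Nullary using (¬_; contradiction)

open Sum +-0-commutativeMonoid using (sum; sum-cong-≗; ∑-distrib-+; ∑-comm)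
open Equivalence using (to; from)
open ≡-Reasoning

ΣFin≡sum : ∀ n (f : Fin n → ℕ) → ΣFin n f ≡ sum f
ΣFin≡sum zero    f = refl
ΣFin≡sum (suc n) f = cong (f zero +_) (ΣFin≡sum n (f ∘ suc))

ΣFin-cong : ∀ n {f g : Fin n → ℕ} → (∀ i → f i ≡ g i) → ΣFin n f ≡ ΣFin n g
ΣFin-cong zero    f≗g = refl
ΣFin-cong (suc n) f≗g = cong₂ _+_ (f≗g zero) (ΣFin-cong n (f≗g ∘ suc))

ΣFin-distrib-+ : ∀ n (f g : Fin n → ℕ) → ΣFin n (λ i → f i + g i) ≡ ΣFin n f + ΣFin n g
ΣFin-distrib-+ n f g = begin
  ΣFin n (λ i → f i + g i)  ≡⟨ ΣFin≡sum n _ ⟩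
  sum (λ i → f i + g i)     ≡⟨ ∑-distrib-+ f g ⟩
  sum f + sum g             ≡⟨ cong₂ _+_ (ΣFin≡sum n f) (ΣFin≡sum n g) ⟨
  ΣFin n f + ΣFin n g       ∎

ΣFin-comm : ∀ m n (f : Fin m → Fin n → ℕ) →
  ΣFin m (λ i → ΣFin n (f i)) ≡ ΣFin n (λ j → ΣFin m (λ i → f i j))
ΣFin-comm m n f = begin
  ΣFin m (λ i → ΣFin n (f i))          ≡⟨ ΣFin²≡sum² m n f ⟩
  sum (λ i → sum (f i))                ≡⟨ ∑-comm f ⟩
  sum (λ j → sum (λ i → f i j))        ≡⟨ ΣFin²≡sum² n m (λ j i → f i j) ⟨
  ΣFin n (λ j → ΣFin m (λ i → f i j))  ∎
  where
  ΣFin²≡sum² : ∀ m n (f : Fin m → Fin n → ℕ) →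
    ΣFin m (λ i → ΣFin n (f i)) ≡ sum (λ i → sum (f i))
  ΣFin²≡sum² m n f = trans (ΣFin≡sum m _) (sum-cong-≗ (λ i → ΣFin≡sum n (f i)))

ΣFin-0 : ∀ n → ΣFin n (λ _ → 0) ≡ 0
ΣFin-0 zero    = refl
ΣFin-0 (suc n) = ΣFin-0 n

ΣFin-1 : ∀ n → ΣFin n (λ _ → 1) ≡ n
ΣFin-1 zero    = refl
ΣFin-1 (suc n) = cong suc (ΣFin-1 n)

ΣFin-suc : ∀ n (f : Fin n → ℕ) → ΣFin n (λ i → suc (f i)) ≡ n + ΣFin n f
ΣFin-suc n f = trans (ΣFin-distrib-+ n (λ _ → 1) f) (cong (_+ ΣFin n f) (ΣFin-1 n))

¬T⇒[]≡0 : ∀ {b} → ¬ T b → [ b ] ≡ 0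
¬T⇒[]≡0 {false} _  = refl
¬T⇒[]≡0 {true}  ¬b = contradiction _ ¬b

T⇒[]≡1 : ∀ {b} → T b → [ b ] ≡ 1
T⇒[]≡1 {true} _ = refl

ΣFin-[∧] : ∀ n b (p : Fin n → Bool) →
  ΣFin n (λ i → [ b ∧ p i ]) ≡ (if b then ΣFin n (λ i → [ p i ]) else 0)
ΣFin-[∧] n true  p = refl
ΣFin-[∧] n false p = ΣFin-0 n

ΣFin-[]-none : ∀ n {p : Fin n → Bool} → (∀ i → ¬ T (p i)) → ΣFin n (λ i → [ p i ]) ≡ 0
ΣFin-[]-none n ¬p = trans (ΣFin-cong n (¬T⇒[]≡0 ∘ ¬p)) (ΣFin-0 n)

ΣFin-[]-unique : ∀ n {p : Fin n → Bool} b →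
  (∀ i → T (p i) ⇔ i ≡ b) → ΣFin n (λ i → [ p i ]) ≡ 1
ΣFin-[]-unique (suc n) zero p⇔ =
  cong₂ _+_ (T⇒[]≡1 (from (p⇔ zero) refl)) (ΣFin-[]-none n λ i → (λ ()) ∘ to (p⇔ (suc i)))
ΣFin-[]-unique (suc n) (suc b) p⇔ =
  cong₂ _+_ (¬T⇒[]≡0 ((λ ()) ∘ to (p⇔ zero)))
            (ΣFin-[]-unique n b λ i →
               mk⇔ (suc-injective ∘ to (p⇔ (suc i))) (from (p⇔ (suc i)) ∘ cong suc))

ΣFin-later : ∀ n (j : Fin n) → ΣFin n (λ i → [ j <F i ]) ≡ n ∸ suc (toℕ j)
ΣFin-later (suc n) zero    = ΣFin-1 n
ΣFin-later (suc n) (suc j) = ΣFin-later n j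

[<ᵇ]+[>ᵇ]+[≡ᵇ]≡1 : ∀ a b → [ a <ᵇ b ] + [ b <ᵇ a ] + [ a ≡ᵇ b ] ≡ 1
[<ᵇ]+[>ᵇ]+[≡ᵇ]≡1 zero    zero    = refl
[<ᵇ]+[>ᵇ]+[≡ᵇ]≡1 zero    (suc b) = refl
[<ᵇ]+[>ᵇ]+[≡ᵇ]≡1 (suc a) zero    = refl
[<ᵇ]+[>ᵇ]+[≡ᵇ]≡1 (suc a) (suc b) = [<ᵇ]+[>ᵇ]+[≡ᵇ]≡1 a b

[∧]-split : ∀ o l {x y z} → [ x ] + [ y ] + [ z ] ≡ 1 →
  [ o ∧ (l ∧ x) ] + [ o ∧ (y ∧ l) ] + [ o ∧ (l ∧ z) ] ≡ [ o ∧ l ]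
[∧]-split false l             _ = refl
[∧]-split true  true  {y = y} h rewrite ∧-identityʳ y = h
[∧]-split true  false {y = y} _ rewrite ∧-zeroʳ y     = refl

≡F⇒≡ : ∀ {n} {i j : Fin n} → (i ≡F j) ≡ true → i ≡ j
≡F⇒≡ {i = i} {j} i≡Fj = toℕ-injective (≡ᵇ⇒≡ (toℕ i) (toℕ j) (from T-≡ i≡Fj))

≡⇒≡F : ∀ {n} {i j : Fin n} → i ≡ j → (i ≡F j) ≡ true
≡⇒≡F {i = i} refl = to T-≡ (≡⇒≡ᵇ (toℕ i) (toℕ i) refl)

-- The local helper anyBelow of isOpener does not depend on w or i, so unfolding
-- isOpener w one step yields literally the recursive call for w ∘ suc.
isOpener-zero : ∀ {n m} (w : Fin (suc n) → Fin m) → isOpener w zero ≡ true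
isOpener-zero {zero}  w = refl
isOpener-zero {suc n} w = isOpener-zero (w ∘ suc)

isOpener-suc : ∀ {n m} (w : Fin (suc n) → Fin m) i →
  isOpener w (suc i) ≡ (if w zero ≡F w (suc i) then false else isOpener (w ∘ suc) i)
isOpener-suc w i with w zero ≡F w (suc i)
... | true  = refl
... | false = refl

earlier-in-block⇒¬isOpener : ∀ {n m} (w : Fin n → Fin m) {a i} →
  a < i → w a ≡ w i → isOpener w i ≡ false
earlier-in-block⇒¬isOpener {suc n} w {zero} {suc i} _ w0≡wi
  rewrite isOpener-suc w i | ≡⇒≡F w0≡wi = refl
earlier-in-block⇒¬isOpener {suc n} w {suc a} {suc i} a<i wa≡wi
  rewrite isOpener-suc w i with w zero ≡F w (suc i)
... | true  = refl
... | false = earlier-in-block⇒¬isOpener (w ∘ suc) (s<s⁻¹ a<i) wa≡wi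

¬isOpener⇒earlier-in-block : ∀ {n m} (w : Fin n → Fin m) i →
  isOpener w i ≡ false → ∃ λ a → a < i × w a ≡ w i
¬isOpener⇒earlier-in-block {suc n} w zero ¬op rewrite isOpener-zero w = contradiction ¬op λ ()
¬isOpener⇒earlier-in-block {suc n} w (suc i) ¬op
  rewrite isOpener-suc w i with w zero ≡F w (suc i) in w0≡Fwi
... | true  = zero , z<s , ≡F⇒≡ w0≡Fwi
... | false with ¬isOpener⇒earlier-in-block (w ∘ suc) i ¬op
...   | a , a<i , wa≡wi = suc a , s<s a<i , wa≡wi

block-opener : ∀ {n m} (w : Fin n → Fin m) i →
  ∃ λ b → isOpener w b ≡ true × toℕ b ≤ toℕ i × w b ≡ w i
block-opener w i = go i (<-wellFounded i)
  where
  go : ∀ i → Acc _<_ i → ∃ λ b → isOpener w b ≡ true × toℕ b ≤ toℕ i × w b ≡ w i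
  go i (acc rec) with isOpener w i in op-i
  ... | true  = i , op-i , ≤-refl , refl
  ... | false with ¬isOpener⇒earlier-in-block w i op-i
  ...   | a , a<i , wa≡wi with go a (rec a<i)
  ...     | b , op-b , b≤a , wb≡wa = b , op-b , ≤-trans b≤a (<⇒≤ a<i) , trans wb≡wa wa≡wi

openers-in-block-unique : ∀ {n m} (w : Fin n → Fin m) {a b} →
  isOpener w a ≡ true → isOpener w b ≡ true → w a ≡ w b → a ≡ b
openers-in-block-unique w {a} {b} op-a op-b wa≡wb with <-cmp a b
... | tri< a<b _ _ = contradiction (trans (sym op-b) (earlier-in-block⇒¬isOpener w a<b wa≡wb)) λ ()
... | tri≈ _ a≡b _ = a≡b
... | tri> _ _ b<a = contradiction (trans (sym op-a) (earlier-in-block⇒¬isOpener w b<a (sym wa≡wb))) λ ()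

module _ {n m : ℕ} (w : Fin n → Fin m) where

  nonOpeners : ℕ
  nonOpeners = ΣFin n (λ i → [ not (isOpener w i) ])

  T-earlier-opener-in-block : ∀ i j →
    T (isOpener w j ∧ ((j <F i) ∧ (w j ≡F w i))) ⇔ (isOpener w j ≡ true × j < i × w j ≡ w i)
  T-earlier-opener-in-block i j = mk⇔ decode encode
    where
    decode : T (isOpener w j ∧ ((j <F i) ∧ (w j ≡F w i))) → isOpener w j ≡ true × j < i × w j ≡ w i
    decode t with to T-∧ t
    ... | op-j , t′ with to T-∧ t′
    ...   | j<i , wj≡wi = to T-≡ op-j , <ᵇ⇒< _ _ j<i , toℕ-injective (≡ᵇ⇒≡ _ _ wj≡wi)
    encode : isOpener w j ≡ true × j < i × w j ≡ w i → T (isOpener w j ∧ ((j <F i) ∧ (w j ≡F w i)))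
    encode (op-j , j<i , wj≡wi) =
      from T-∧ (from T-≡ op-j , from T-∧ (<⇒<ᵇ j<i , ≡⇒≡ᵇ _ _ (cong toℕ wj≡wi)))

  ΣFin-earlier-openers-in-block : ∀ i →
    ΣFin n (λ j → [ isOpener w j ∧ ((j <F i) ∧ (w j ≡F w i)) ]) ≡ [ not (isOpener w i) ]
  ΣFin-earlier-openers-in-block i with isOpener w i in op-i
  ... | true  = ΣFin-[]-none n λ j t →
    let (_ , j<i , wj≡wi) = to (T-earlier-opener-in-block i j) t
    in contradiction (trans (sym op-i) (earlier-in-block⇒¬isOpener w j<i wj≡wi)) λ ()
  ... | false with ¬isOpener⇒earlier-in-block w i op-i
  ...   | a , a<i , wa≡wi with block-opener w a
  ...     | b , op-b , b≤a , wb≡wa = ΣFin-[]-unique n b λ j → mk⇔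
    (λ t → let (op-j , _ , wj≡wi) = to (T-earlier-opener-in-block i j) t
           in openers-in-block-unique w op-j op-b (trans wj≡wi (sym wb≡wi)))
    (λ { refl → from (T-earlier-opener-in-block i b) (op-b , ≤-trans (s≤s b≤a) a<i , wb≡wi) })
    where
    wb≡wi : w b ≡ w i
    wb≡wi = trans wb≡wa wa≡wi

  los+linvO+nonOpeners :
    los w + linvO w + nonOpeners ≡ ΣFin n (λ j → if isOpener w j then n ∸ suc (toℕ j) else 0)
  los+linvO+nonOpeners = begin
    los w + linvO w + nonOpeners
      ≡⟨ cong₂ (λ l z → los w + l + z) linvO≡ΣΣ nonOpeners≡ΣΣ ⟩
    ΣΣ lesser + ΣΣ greater + ΣΣ same
      ≡⟨ trans (ΣΣ-distrib-+ _ same) (cong (_+ ΣΣ same) (ΣΣ-distrib-+ lesser greater)) ⟨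
    ΣΣ (λ i j → lesser i j + greater i j + same i j)
      ≡⟨ ΣΣ-cong (λ i j → [∧]-split (isOpener w j) (j <F i)
                              ([<ᵇ]+[>ᵇ]+[≡ᵇ]≡1 (toℕ (w j)) (toℕ (w i)))) ⟩
    ΣΣ (λ i j → [ isOpener w j ∧ (j <F i) ])
      ≡⟨ ΣFin-comm n n _ ⟩
    ΣFin n (λ j → ΣFin n (λ i → [ isOpener w j ∧ (j <F i) ]))
      ≡⟨ ΣFin-cong n (λ j → trans (ΣFin-[∧] n (isOpener w j) (j <F_))
                                   (cong (if isOpener w j then_else 0) (ΣFin-later n j))) ⟩
    ΣFin n (λ j → if isOpener w j then n ∸ suc (toℕ j) else 0)
      ∎
    where
    ΣΣ : (Fin n → Fin n → ℕ) → ℕ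
    ΣΣ f = ΣFin n (λ i → ΣFin n (f i))
    ΣΣ-cong : ∀ {f g : Fin n → Fin n → ℕ} → (∀ i j → f i j ≡ g i j) → ΣΣ f ≡ ΣΣ g
    ΣΣ-cong f≗g = ΣFin-cong n (λ i → ΣFin-cong n (f≗g i))
    ΣΣ-distrib-+ : ∀ f g → ΣΣ (λ i j → f i j + g i j) ≡ ΣΣ f + ΣΣ g
    ΣΣ-distrib-+ f g = trans (ΣFin-cong n (λ i → ΣFin-distrib-+ n (f i) (g i))) (ΣFin-distrib-+ n _ _)
    lesser greater same : Fin n → Fin n → ℕ
    lesser  i j = [ isOpener w j ∧ ((j <F i) ∧ (w j <F w i)) ]
    greater i j = [ isOpener w j ∧ ((w i <F w j) ∧ (j <F i)) ]
    same    i j = [ isOpener w j ∧ ((j <F i) ∧ (w j ≡F w i)) ]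
    linvO≡ΣΣ : linvO w ≡ ΣΣ greater
    linvO≡ΣΣ = trans (ΣFin-cong n (λ j → sym (ΣFin-[∧] n (isOpener w j) _))) (ΣFin-comm n n _)
    nonOpeners≡ΣΣ : nonOpeners ≡ ΣΣ same
    nonOpeners≡ΣΣ = sym (ΣFin-cong n ΣFin-earlier-openers-in-block)

-- The term n − 1 of the opener 0, spread as 1 over every later element, raises the
-- term of each later opener by one and accounts for each non-opener.
ΣFin-opener-distances : ∀ {n m} (w : Fin n → Fin m) →
  ΣFin n (λ j → if isOpener w j then n ∸ suc (toℕ j) else 0)
    ≡ ΣFin n (λ x → if isOpener w x ∧ not (toℕ x ≡ᵇ 0) then n ∸ toℕ x else 0) + nonOpeners w
ΣFin-opener-distances {zero}  w = refl
ΣFin-opener-distances {suc n} w rewrite isOpener-zero w = begin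
  n + ΣFin n (λ y → later (op y) y)
    ≡⟨ ΣFin-suc n _ ⟨
  ΣFin n (λ y → suc (later (op y) y))
    ≡⟨ ΣFin-cong n (λ y → suc-later (op y) y) ⟩
  ΣFin n (λ y → (if op y ∧ true then n ∸ toℕ y else 0) + [ not (op y) ])
    ≡⟨ ΣFin-distrib-+ n _ _ ⟩
  ΣFin n (λ y → if op y ∧ true then n ∸ toℕ y else 0) + ΣFin n (λ y → [ not (op y) ])
    ∎
  where
  op : Fin n → Bool
  op y = isOpener w (suc y)
  later : Bool → Fin n → ℕ
  later o y = if o then n ∸ suc (toℕ y) else 0
  suc-later : ∀ o y → suc (later o y) ≡ (if o ∧ true then n ∸ toℕ y else 0) + [ not o ]
  suc-later true  y = sym (trans (+-identityʳ _) (+-∸-assoc 1 (toℕ<n y)))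
  suc-later false y = refl

los+linvO : ∀ {n m} (w : Fin n → Fin m) →
  los w + linvO w ≡ ΣFin n (λ x → if isOpener w x ∧ not (toℕ x ≡ᵇ 0) then n ∸ toℕ x else 0)
los+linvO w = +-cancelʳ-≡ (nonOpeners w) _ _ (trans (los+linvO+nonOpeners w) (ΣFin-opener-distances w))

mainTheorem5 : (n k : ℕ) → 1 ≤ n →
    (O : Subset n) → ∣ O ∣ ≡ suc k →
    Σ (Fin n) (λ one → (toℕ one ≡ 0) × (one ∈ O)) →
    (w : Fin n → Fin (suc k)) → IsOrderedPartition n (suc k) w →
    ((i : Fin n) → (i ∈ O → isOpener w i ≡ true) × (isOpener w i ≡ true → i ∈ O)) →
    los w + linvO w ≡ ΣFin n (λ x → if lookup O x ∧ not (toℕ x ≡ᵇ 0) then n ∸ toℕ x else 0)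
-- Only the last hypothesis matters: los+linvO holds for every block map.
mainTheorem5 n _ _ O _ _ w _ O≡openers = begin
  los w + linvO w
    ≡⟨ los+linvO w ⟩
  ΣFin n (λ x → if isOpener w x ∧ not (toℕ x ≡ᵇ 0) then n ∸ toℕ x else 0)
    ≡⟨ ΣFin-cong n (λ x → cong (λ o → if o ∧ not (toℕ x ≡ᵇ 0) then n ∸ toℕ x else 0)
                               (isOpener≡lookup x)) ⟩
  ΣFin n (λ x → if lookup O x ∧ not (toℕ x ≡ᵇ 0) then n ∸ toℕ x else 0)
    ∎
  where
  isOpener≡lookup : ∀ x → isOpener w x ≡ lookup O x
  isOpener≡lookup x =
    ⇔→≡ (mk⇔ ([]=⇒lookup ∘ proj₂ (O≡openers x)) (proj₁ (O≡openers x) ∘ lookup⇒[]= x O))
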